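{- For every integer $n\ge 1$ there is a normal natural deduction proof of $\varphi_n$ in purely implicational minimal propositional logic $\mathbf{M}_{\rightarrow}$ having $2^n$ assumption occurrences of the same formula, all of which are discharged by the last inference rule of the proof.
   Context: Purely implicational minimal propositional logic $\mathbf{M}_{\rightarrow}$: formulas are built from propositional letters using only $\rightarrow$ (there is no $\bot$). Its natural deduction system (Prawitz style) has exactly two rules: $\rightarrow$-Introduction (from a derivation of $\beta$ from assumptions possibly including occurrences of $\alpha$, infer $\alpha\rightarrow\beta$, discharging any number of those occurrences of $\alpha$) and $\rightarrow$-Elimination (from $\alpha$ (minor premise) and $\alpha\rightarrow\beta$ (major premise) infer $\beta$). A proof is a derivation with no open (undischarged) assumptions; an assumption occurrence of a formula is a leaf of the derivation tree labelled by that formula. A derivation is normal if no formula occurrence is both the conclusion of an $\rightarrow$-Introduction and the major premise of an $\rightarrow$-Elimination. Let $C$ and $D_1,D_2,\dots$ be distinct propositional letters. For formulas $X,Y$ put $\chi[X,Y]=(((X\rightarrow Y)\rightarrow X)\rightarrow X)\rightarrow Y$. Define $\xi_1=\chi[D_1,C]$, $\xi_{i+1}=\chi[D_{i+1},\xi_i]$ for $i\ge 1$, and $\varphi_i=\xi_i\rightarrow C$ for $i\ge1$. -}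

module Defs where

open import Data.Nat using (ℕ; zero; suc; _+_)
open import Data.List using (List; []; _∷_)
open import Data.Product using (_×_; _,_)
open import Data.Unit using (⊤; tt)
open import Data.Empty using (⊥)
open import Relation.Nullary using (Dec; yes; no)
open import Relation.Binary.PropositionalEquality using (_≡_; refl)
open import Data.Nat using (_≟_)

infixr 20 _⇒_
data Form : Set where
  atom : ℕ → Form
  _⇒_  : Form → Form → Form

atom-inj : ∀ {m n} → atom m ≡ atom n → m ≡ n
atom-inj refl = refl

⇒-injˡ : ∀ {a b c d} → (a ⇒ b) ≡ (c ⇒ d) → a ≡ c
⇒-injˡ refl = refl

⇒-injʳ : ∀ {a b c d} → (a ⇒ b) ≡ (c ⇒ d) → b ≡ d
⇒-injʳ refl = refl

_≟F_ : (x y : Form) → Dec (x ≡ y)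
atom m ≟F atom n with m ≟ n
... | yes refl = yes refl
... | no m≢n = no (λ e → m≢n (atom-inj e))
atom m ≟F (c ⇒ d) = no (λ ())
(a ⇒ b) ≟F atom n = no (λ ())
(a ⇒ b) ≟F (c ⇒ d) with a ≟F c | b ≟F d
... | yes refl | yes refl = yes refl
... | no a≢c | _ = no (λ e → a≢c (⇒-injˡ e))
... | yes _ | no b≢d = no (λ e → b≢d (⇒-injʳ e))

-- The specific formulas.  C is letter 0, Dᵢ is letter i (i ≥ 1): distinct.

C : Form
C = atom 0

D : ℕ → Form
D i = atom i

χ : Form → Form → Form
χ X Y = (((X ⇒ Y) ⇒ X) ⇒ X) ⇒ Y

ξ : ℕ → Form
ξ zero = C
ξ (suc zero) = χ (D 1) C
ξ (suc (suc k)) = χ (D (suc (suc k))) (ξ (suc k))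

φ : ℕ → Form
φ i = ξ i ⇒ C

-- A derivation in context Γ : List Form is a derivation tree in which
-- every assumption leaf is discharged by some →I below it; Γ lists the
-- discharged formulas of the enclosing →I rules (innermost first), and an
-- assumption leaf records (by a de Bruijn position) which →I discharges it.
-- Hence a derivation in the empty context is exactly a proof (no open
-- assumptions).  →I may discharge any number (including zero) of
-- occurrences of its antecedent.

data _∋_ : List Form → Form → Set where
  here  : ∀ {Γ A} → (A ∷ Γ) ∋ A
  there : ∀ {Γ A B} → Γ ∋ A → (B ∷ Γ) ∋ A

data Deriv (Γ : List Form) : Form → Set where
  hyp  : ∀ {A} → Γ ∋ A → Deriv Γ A
  ⇒I   : ∀ {A B} → Deriv (A ∷ Γ) B → Deriv Γ (A ⇒ B)
  ⇒E   : ∀ {A B} → Deriv Γ (A ⇒ B) → Deriv Γ A → Deriv Γ B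

Proof : Form → Set
Proof A = Deriv [] A

IsIntro : ∀ {Γ A} → Deriv Γ A → Set
IsIntro (hyp _) = ⊥
IsIntro (⇒I _) = ⊤
IsIntro (⇒E _ _) = ⊥

NotIntro : ∀ {Γ A} → Deriv Γ A → Set
NotIntro (hyp _) = ⊤
NotIntro (⇒I _) = ⊥
NotIntro (⇒E _ _) = ⊤

Normal : ∀ {Γ A} → Deriv Γ A → Set
Normal (hyp _) = ⊤
Normal (⇒I d) = Normal d
Normal (⇒E d e) = NotIntro d × Normal d × Normal e

occurrences : ∀ {Γ A} → Form → Deriv Γ A → ℕ
occurrences {A = A} F (hyp _) with A ≟F F
... | yes _ = 1
... | no _ = 0
occurrences F (⇒I d) = occurrences F d
occurrences F (⇒E d e) = occurrences F d + occurrences F e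

-- Position (0 = innermost) of the →I discharging an assumption leaf.
pos : ∀ {Γ A} → Γ ∋ A → ℕ
pos here = 0
pos (there x) = suc (pos x)

dischargedAt : ∀ {Γ A} → ℕ → Deriv Γ A → ℕ
dischargedAt k (hyp x) with pos x ≟ k
... | yes _ = 1
... | no _ = 0
dischargedAt k (⇒I d) = dischargedAt (suc k) d
dischargedAt k (⇒E d e) = dischargedAt k d + dischargedAt k e

dischargedByLast : ∀ {Γ A B} → Deriv (A ∷ Γ) B → ℕ
dischargedByLast d = dischargedAt 0 d

module Submission where

-- Idea of the proof.  The formula χ[X,Y] = (((X→Y)→X)→X)→Y yields Y from
-- two copies of itself:
--
--   χ[X,Y]   ((X→Y)→X)→X  given by  λh. h (λx. d₂ (λ_. x))
--   ─────────────────────────────────────────────────────── →E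
--                              Y
--
-- where d₂ is a second derivation of χ[X,Y], built under the local
-- hypotheses h : (X→Y)→X and x : X.  The result is normal as soon as both
-- copies are normal and neither ends with →I.  Since ξ_{m+1} = χ[D_{m+1},ξ_m],
-- one such step turns derivations of ξ_{m+1} into a derivation of ξ_m and
-- doubles the number of leaves labelled by the top hypothesis.  Iterating
-- j times from an assumption ξ_{j+m} gives a normal derivation of ξ_m
-- with 2^j leaves ξ_{j+m}, all discharged by the binder of that assumption.
-- For j = n and m = 0 (where ξ_0 = C), discharging ξ_n proves φ_n.

open import Defs
open import Data.Nat using (ℕ; zero; suc; _+_; _≤_; _^_; _≟_)
open import Data.Nat.Properties using (+-identityʳ; +-suc)
open import Data.Product using (Σ; _×_; _,_; proj₁)
open import Data.List using ([]; _∷_)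
open import Data.Unit using (tt)
open import Data.Empty using (⊥-elim)
open import Relation.Nullary using (¬_; yes; no)
open import Relation.Binary.PropositionalEquality
  using (_≡_; refl; sym; trans; cong; cong₂; module ≡-Reasoning)

leaf-occurrences-self : ∀ {Γ A} (x : Γ ∋ A) → occurrences A (hyp x) ≡ 1
leaf-occurrences-self {A = A} x with A ≟F A
... | yes _ = refl
... | no A≢A = ⊥-elim (A≢A refl)

leaf-occurrences-other : ∀ {Γ A} F (x : Γ ∋ A) → ¬ (A ≡ F) → occurrences F (hyp x) ≡ 0
leaf-occurrences-other {A = A} F x A≢F with A ≟F F
... | yes A≡F = ⊥-elim (A≢F A≡F)
... | no _ = refl

leaf-discharged-self : ∀ {Γ A} (x : Γ ∋ A) → dischargedAt (pos x) (hyp x) ≡ 1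
leaf-discharged-self x with pos x ≟ pos x
... | yes _ = refl
... | no p≢p = ⊥-elim (p≢p refl)

-- Derivations that are normal and do not end with →I: these may serve as
-- major premises of →E without creating a detour.
Neutral : ∀ {Γ A} → Deriv Γ A → Set
Neutral d = Normal d × NotIntro d

χ-elim : ∀ {Γ X Y} → Deriv Γ (χ X Y) → Deriv (X ∷ ((X ⇒ Y) ⇒ X) ∷ Γ) (χ X Y) → Deriv Γ Y
χ-elim d₁ d₂ = ⇒E d₁ (⇒I (⇒E (hyp here) (⇒I (⇒E d₂ (⇒I (hyp (there here)))))))

-- The only major premises in the χ-step are d₁, d₂ and the leaf h.
χ-elim-neutral : ∀ {Γ X Y} (d₁ : Deriv Γ (χ X Y)) d₂ →
  Neutral d₁ → Neutral d₂ → Neutral (χ-elim d₁ d₂)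
χ-elim-neutral d₁ d₂ (normal₁ , neutral₁) (normal₂ , neutral₂) =
  (neutral₁ , normal₁ , tt , tt , neutral₂ , normal₂ , tt) , tt

χ-elim-occurrences : ∀ {Γ X Y} F (d₁ : Deriv Γ (χ X Y)) d₂ →
  ¬ (((X ⇒ Y) ⇒ X) ≡ F) → ¬ (X ≡ F) →
  occurrences F (χ-elim d₁ d₂) ≡ occurrences F d₁ + occurrences F d₂
χ-elim-occurrences {Γ} {X} {Y} F d₁ d₂ h≢F x≢F = cong (occurrences F d₁ +_) (begin
    occurrences F (hyp h) + (occurrences F d₂ + occurrences F (hyp x))
      ≡⟨ cong₂ (λ a b → a + (occurrences F d₂ + b))
               (leaf-occurrences-other F h h≢F) (leaf-occurrences-other F x x≢F) ⟩
    occurrences F d₂ + 0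
      ≡⟨ +-identityʳ _ ⟩
    occurrences F d₂ ∎)
  where
  open ≡-Reasoning
  h : (((X ⇒ Y) ⇒ X) ∷ Γ) ∋ ((X ⇒ Y) ⇒ X)
  h = here
  x : (X ∷ ((X ⇒ Y) ⇒ X) ∷ Γ) ∋ X
  x = here

-- Discharges by an outer →I add up; the local leaves h and x are
-- discharged inside the step.  (d₂ sits under two extra binders.)
χ-elim-discharged : ∀ {Γ X Y} k (d₁ : Deriv Γ (χ X Y)) d₂ →
  dischargedAt k (χ-elim d₁ d₂) ≡ dischargedAt k d₁ + dischargedAt (suc (suc k)) d₂
χ-elim-discharged k d₁ d₂ = cong (dischargedAt k d₁ +_) (+-identityʳ _)

ξ-step : ∀ {Γ} m → Deriv Γ (ξ (suc m)) →
  Deriv (D (suc m) ∷ ((D (suc m) ⇒ ξ m) ⇒ D (suc m)) ∷ Γ) (ξ (suc m)) → Deriv Γ (ξ m)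
ξ-step zero = χ-elim
ξ-step (suc m) = χ-elim

ξ-step-neutral : ∀ {Γ} m (d₁ : Deriv Γ (ξ (suc m))) d₂ →
  Neutral d₁ → Neutral d₂ → Neutral (ξ-step m d₁ d₂)
ξ-step-neutral zero = χ-elim-neutral
ξ-step-neutral (suc m) = χ-elim-neutral

ξ-step-discharged : ∀ {Γ} m k (d₁ : Deriv Γ (ξ (suc m))) d₂ →
  dischargedAt k (ξ-step m d₁ d₂) ≡ dischargedAt k d₁ + dischargedAt (suc (suc k)) d₂
ξ-step-discharged zero = χ-elim-discharged
ξ-step-discharged (suc m) = χ-elim-discharged

-- No ξ-formula has a letter as the antecedent of its antecedent (this rules
-- out the hypothesis h of a χ-step) ...
ξ-not-hypothesis : ∀ N a B E → ¬ (((atom a ⇒ B) ⇒ E) ≡ ξ N)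
ξ-not-hypothesis zero a B E ()
ξ-not-hypothesis (suc zero) a B E ()
ξ-not-hypothesis (suc (suc N)) a B E ()

-- ... and no ξ-formula is one of the letters Dᵢ (this rules out x).
ξ-not-D : ∀ N i → ¬ (D (suc i) ≡ ξ N)
ξ-not-D zero i ()
ξ-not-D (suc zero) i ()
ξ-not-D (suc (suc N)) i ()

ξ-step-occurrences : ∀ {Γ} n m (d₁ : Deriv Γ (ξ (suc m))) d₂ →
  occurrences (ξ n) (ξ-step m d₁ d₂) ≡ occurrences (ξ n) d₁ + occurrences (ξ n) d₂
ξ-step-occurrences n zero d₁ d₂ =
  χ-elim-occurrences (ξ n) d₁ d₂ (ξ-not-hypothesis n 1 C (D 1)) (ξ-not-D n 0)
ξ-step-occurrences n (suc m) d₁ d₂ =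
  χ-elim-occurrences (ξ n) d₁ d₂ (ξ-not-hypothesis n (suc (suc m)) (ξ (suc m)) (D (suc (suc m))))
    (ξ-not-D n (suc m))

descend : ∀ {Γ n} j m → Γ ∋ ξ n → j + m ≡ n → Deriv Γ (ξ m)
descend zero m x refl = hyp x
descend {n = n} (suc j) m x e =
  ξ-step m (descend j (suc m) x e′) (descend j (suc m) (there (there x)) e′)
  where
  e′ : j + suc m ≡ n
  e′ = trans (+-suc j m) e

descend-neutral : ∀ {Γ n} j m (x : Γ ∋ ξ n) (e : j + m ≡ n) → Neutral (descend j m x e)
descend-neutral zero m x refl = tt , tt
descend-neutral {n = n} (suc j) m x e =
  ξ-step-neutral m _ _ (descend-neutral j (suc m) x e′) (descend-neutral j (suc m) (there (there x)) e′)
  where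
  e′ : j + suc m ≡ n
  e′ = trans (+-suc j m) e

2^j+2^j≡2^suc-j : ∀ j → 2 ^ j + 2 ^ j ≡ 2 ^ suc j
2^j+2^j≡2^suc-j j = cong (2 ^ j +_) (sym (+-identityʳ (2 ^ j)))

descend-occurrences : ∀ {Γ n} j m (x : Γ ∋ ξ n) (e : j + m ≡ n) →
  occurrences (ξ n) (descend j m x e) ≡ 2 ^ j
descend-occurrences zero m x refl = leaf-occurrences-self x
descend-occurrences {Γ} {n} (suc j) m x e = begin
  occurrences (ξ n) (ξ-step m d₁ d₂)        ≡⟨ ξ-step-occurrences n m d₁ d₂ ⟩
  occurrences (ξ n) d₁ + occurrences (ξ n) d₂
    ≡⟨ cong₂ _+_ (descend-occurrences j (suc m) x e′)
                 (descend-occurrences j (suc m) (there (there x)) e′) ⟩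
  2 ^ j + 2 ^ j                              ≡⟨ 2^j+2^j≡2^suc-j j ⟩
  2 ^ suc j                                  ∎
  where
  open ≡-Reasoning
  e′ : j + suc m ≡ n
  e′ = trans (+-suc j m) e
  d₁ : Deriv Γ (ξ (suc m))
  d₂ : Deriv (D (suc m) ∷ ((D (suc m) ⇒ ξ m) ⇒ D (suc m)) ∷ Γ) (ξ (suc m))
  d₁ = descend j (suc m) x e′
  d₂ = descend j (suc m) (there (there x)) e′

descend-discharged : ∀ {Γ n} j m (x : Γ ∋ ξ n) (e : j + m ≡ n) →
  dischargedAt (pos x) (descend j m x e) ≡ 2 ^ j
descend-discharged zero m x refl = leaf-discharged-self x
descend-discharged {Γ} {n} (suc j) m x e = begin
  dischargedAt (pos x) (ξ-step m d₁ d₂)     ≡⟨ ξ-step-discharged m (pos x) d₁ d₂ ⟩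
  dischargedAt (pos x) d₁ + dischargedAt (suc (suc (pos x))) d₂
    ≡⟨ cong₂ _+_ (descend-discharged j (suc m) x e′)
                 (descend-discharged j (suc m) (there (there x)) e′) ⟩
  2 ^ j + 2 ^ j                              ≡⟨ 2^j+2^j≡2^suc-j j ⟩
  2 ^ suc j                                  ∎
  where
  open ≡-Reasoning
  e′ : j + suc m ≡ n
  e′ = trans (+-suc j m) e
  d₁ : Deriv Γ (ξ (suc m))
  d₂ : Deriv (D (suc m) ∷ ((D (suc m) ⇒ ξ m) ⇒ D (suc m)) ∷ Γ) (ξ (suc m))
  d₁ = descend j (suc m) x e′
  d₂ = descend j (suc m) (there (there x)) e′

-- The proof of φ_n = ξ_n → C: descend all n levels from the assumption ξ_n
-- (to ξ_0 = C) and discharge it.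
proposition1 : (n : ℕ) → 1 ≤ n →
    Σ (Deriv (ξ n ∷ []) C) λ body →
      Normal {[]} (⇒I body)
      × occurrences (ξ n) (⇒I body) ≡ 2 ^ n
      × dischargedByLast body ≡ 2 ^ n
proposition1 n _ =
  body , proj₁ (descend-neutral n 0 here n+0≡n)
       , descend-occurrences n 0 here n+0≡n
       , descend-discharged n 0 here n+0≡n
  where
  n+0≡n : n + 0 ≡ n
  n+0≡n = +-identityʳ n
  body : Deriv (ξ n ∷ []) C
  body = descend n 0 here n+0≡n
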